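{- Let $m$ and $M$ be positive integers such that $\rho (m,M) \geq 4$. Then either $\min (m,M) \geq 320$ or $\min (m,M)\in \{ 255, 286 \}$; moreover, in the latter two cases, $\rho (m,M) = 4$.
   Context: For positive integers $m,M$ define $\rho(m,M)=\min\{t\in\mathbb{Z}_{\ge 0} : \exists\, t'\in\mathbb{Z},\ 0\le t'\le t,\ \gcd(M-t',\,m-(t-t'))=1\}$. -}

module Defs where

open import Data.Nat using (ℕ; _≤_; _<_)
open import Data.Integer as ℤ using (ℤ; +_; _-_; 1ℤ)
open import Data.Integer.GCD using (gcd)
open import Data.Product using (Σ; _×_)
open import Relation.Binary.PropositionalEquality using (_≡_)
open import Relation.Nullary using (¬_)

-- Good m M t : ∃ t' ∈ ℤ with 0 ≤ t' ≤ t and gcd(M - t', m - (t - t')) = 1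
-- (t' ranges over naturals ≤ t; the differences are computed in ℤ and may be ≤ 0;
--  gcd over ℤ is the gcd of absolute values, as in the library).
Good : ℕ → ℕ → ℕ → Set
Good m M t = Σ ℕ λ t' → (t' ≤ t) ×
  (gcd (+ M - + t') (+ m - (+ t - + t')) ≡ 1ℤ)

IsRho : ℕ → ℕ → ℕ → Set
IsRho m M r = Good m M r × (∀ t → t < r → ¬ Good m M t)

{-# OPTIONS --safe #-}
-- If gcd(M − a, m − b) = 1 then ρ(m, M) ≤ a + b. So ρ(m, M) < t for every M as soon as
-- j(m − b) ≤ t − b for some b < min(m, t), where j is Jacobsthal's function: every j(n)
-- consecutive integers contain one coprime to n. Coprimality to n only depends on the
-- residue mod n, so such bounds are decidable, and a finite search finds a suitable b for
-- t = 4 and each 0 < m < 320 except 255 and 286, and for t = 5 at those two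
-- (j(255) ≤ 5, j(283) ≤ 2). As ρ is symmetric, m may be taken to be min(m, M).
module Submission where

open import Defs
open import Data.Nat using (ℕ; _≤_; _<_; _⊓_)
open import Data.Product using (_×_)
open import Data.Sum using (_⊎_)
open import Relation.Binary.PropositionalEquality using (_≡_)

open import Data.Nat as ℕ using (_+_; _*_; _∸_; NonZero; >-nonZero; s≤s⁻¹)
open import Data.Nat.Properties
  using (_≟_; _<?_; _≤?_; ≰⇒>; ≮⇒≥; ≤⇒≯; <⇒≤; <-irrefl; ≤-antisym; +-comm; ⊓-sel; ⊓-glb;
         m≤m+n; m+n∸m≡n; m+[n∸m]≡n; m∸n+n≡m; m<n⇒0<n∸m; +-monoˡ-<; anyUpTo?; allUpTo?;
         module ≤-Reasoning)
open import Data.Nat.DivMod using (_%_; _/_; m%n<n; m≡m%n+[m/n]*n)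
open import Data.Nat.Divisibility using (∣1⇒≡1)
open import Data.Integer as ℤ using (ℤ; +_; _-_; 1ℤ)
open import Data.Integer.Properties using (m-n≡m⊖n; ⊖-≥; pos-+; pos-*)
open import Data.Integer.GCD using (gcd; gcd[i,j]∣i; gcd[i,j]∣j; gcd-greatest; gcd-comm)
import Data.Integer.Divisibility as Unsigned
open import Data.Integer.Divisibility.Signed using (_∣_; ∣ᵤ⇒∣; ∣⇒∣ᵤ; ∣m+n∣n⇒∣m; ∣n⇒∣m*n)
open import Data.Integer.Tactic.RingSolver using (solve-∀)
open import Data.Product using (∃-syntax; ∃₂; _,_; proj₁; proj₂)
open import Data.Sum using (inj₁; inj₂)
open import Data.Empty using (⊥-elim)
open import Function using (_∘_)
open import Relation.Nullary using (Dec; yes; no; _⊎-dec_; contradiction)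
open import Relation.Nullary.Decidable using (toWitness; map′)
open import Relation.Binary.PropositionalEquality using (refl; sym; trans; cong; subst; module ≡-Reasoning)

pos-∸ : ∀ {m n} → n ≤ m → + (m ∸ n) ≡ + m - + n
pos-∸ {m} {n} n≤m = sym (trans (m-n≡m⊖n m n) (⊖-≥ n≤m))

coprime⇒Good : ∀ {m M a b} → gcd (+ M - + a) (+ m - + b) ≡ 1ℤ → Good m M (a + b)
coprime⇒Good {m} {M} {a} {b} cop =
  a , m≤m+n a b , subst (λ x → gcd (+ M - + a) (+ m - x) ≡ 1ℤ) (sym a+b-a≡b) cop
  where
  a+b-a≡b : + (a + b) - + a ≡ + b
  a+b-a≡b = trans (sym (pos-∸ (m≤m+n a b))) (cong +_ (m+n∸m≡n a b))

Good⇒coprime : ∀ {m M t} → Good m M t →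
  ∃₂ λ a b → a + b ≡ t × gcd (+ M - + a) (+ m - + b) ≡ 1ℤ
Good⇒coprime {m} {M} {t} (a , a≤t , cop) =
  a , t ∸ a , m+[n∸m]≡n a≤t ,
  subst (λ x → gcd (+ M - + a) (+ m - x) ≡ 1ℤ) (sym (pos-∸ a≤t)) cop

Good-comm : ∀ {m M t} → Good m M t → Good M m t
Good-comm {m} {M} good with Good⇒coprime good
... | a , b , refl , cop =
  subst (Good M m) (+-comm b a)
        (coprime⇒Good {M} {m} {b} {a} (trans (gcd-comm (+ m - + b) (+ M - + a)) cop))

IsRho-comm : ∀ {m M r} → IsRho m M r → IsRho M m r
IsRho-comm (good , least) = Good-comm good , λ t t<r → least t t<r ∘ Good-comm

IsRho-⊓ : ∀ {m M r} → IsRho m M r → ∃[ N ] IsRho (m ⊓ M) N r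
IsRho-⊓ {m} {M} {r} ρ with ⊓-sel m M
... | inj₁ m⊓M≡m = M , subst (λ n → IsRho n M r) (sym m⊓M≡m) ρ
... | inj₂ m⊓M≡M = m , subst (λ n → IsRho n m r) (sym m⊓M≡M) (IsRho-comm ρ)

IsRho⇒≤ : ∀ {m M r t} → IsRho m M r → Good m M t → r ≤ t
IsRho⇒≤ (_ , least) good = ≮⇒≥ λ t<r → least _ t<r good

gcd[i,j]≡1⇒gcd[i+k*j,j]≡1 : ∀ i j k → gcd i j ≡ 1ℤ → gcd (i ℤ.+ k ℤ.* j) j ≡ 1ℤ
gcd[i,j]≡1⇒gcd[i+k*j,j]≡1 i j k gcd[i,j]≡1 =
  cong +_ (∣1⇒≡1 (subst (g Unsigned.∣_) gcd[i,j]≡1 (gcd-greatest {i} {j} {g} (∣⇒∣ᵤ g∣i) (∣⇒∣ᵤ g∣j))))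
  where
  g : ℤ
  g = gcd (i ℤ.+ k ℤ.* j) j
  g∣j : g ∣ j
  g∣j = ∣ᵤ⇒∣ (gcd[i,j]∣j (i ℤ.+ k ℤ.* j) j)
  g∣i : g ∣ i
  g∣i = ∣m+n∣n⇒∣m (∣ᵤ⇒∣ (gcd[i,j]∣i (i ℤ.+ k ℤ.* j) j)) (∣n⇒∣m*n k g∣j)

CoprimeInWindow : ℕ → ℕ → ℕ → Set
CoprimeInWindow n k M = ∃[ a ] a < k × gcd (+ M - + a) (+ n) ≡ 1ℤ

JacobsthalBound : ℕ → ℕ → Set
JacobsthalBound n k = ∀ M → CoprimeInWindow n k M

coprimeInWindow-% : ∀ {n k} M .{{_ : NonZero n}} →
  CoprimeInWindow n k (M % n) → CoprimeInWindow n k M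
coprimeInWindow-% {n} M (a , a<k , cop) =
  a , a<k , subst (λ x → gcd x (+ n) ≡ 1ℤ) (sym M-a≡[M%n-a]+[M/n]*n)
                (gcd[i,j]≡1⇒gcd[i+k*j,j]≡1 (+ (M % n) - + a) (+ n) (+ (M / n)) cop)
  where
  open ≡-Reasoning
  rearrange : ∀ x y z → x ℤ.+ y - z ≡ (x - z) ℤ.+ y
  rearrange = solve-∀
  M-a≡[M%n-a]+[M/n]*n : + M - + a ≡ (+ (M % n) - + a) ℤ.+ + (M / n) ℤ.* + n
  M-a≡[M%n-a]+[M/n]*n = begin
    + M - + a                               ≡⟨ cong (λ x → + x - + a) (m≡m%n+[m/n]*n M n) ⟩
    + (M % n + M / n * n) - + a             ≡⟨ cong (_- + a) (pos-+ (M % n) (M / n * n)) ⟩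
    + (M % n) ℤ.+ + (M / n * n) - + a       ≡⟨ cong (λ x → + (M % n) ℤ.+ x - + a) (pos-* (M / n) n) ⟩
    + (M % n) ℤ.+ + (M / n) ℤ.* + n - + a   ≡⟨ rearrange (+ (M % n)) (+ (M / n) ℤ.* + n) (+ a) ⟩
    (+ (M % n) - + a) ℤ.+ + (M / n) ℤ.* + n ∎

coprimeInWindow? : ∀ n k M → Dec (CoprimeInWindow n k M)
coprimeInWindow? n k M = anyUpTo? (λ a → gcd (+ M - + a) (+ n) ℤ.≟ 1ℤ) k

jacobsthalBound? : ∀ n .{{_ : NonZero n}} k → Dec (JacobsthalBound n k)
jacobsthalBound? n k =
  map′ (λ onResidues M → coprimeInWindow-% M (onResidues (m%n<n M n)))
       (λ bound {M} _ → bound M)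
       (allUpTo? (coprimeInWindow? n k) n)

ρ<Certificate : ℕ → ℕ → Set
ρ<Certificate t n = ∃[ b ] b < t × b < n × JacobsthalBound (n ∸ b) (t ∸ b)

ρ<Certificate? : ∀ t n → Dec (ρ<Certificate t n)
ρ<Certificate? t n = anyUpTo? shift? t
  where
  shift? : ∀ b → Dec (b < n × JacobsthalBound (n ∸ b) (t ∸ b))
  shift? b with b <? n
  ... | no b≮n  = no (b≮n ∘ proj₁)
  ... | yes b<n = map′ (b<n ,_) proj₂
                       (jacobsthalBound? (n ∸ b) {{>-nonZero (m<n⇒0<n∸m b<n)}} (t ∸ b))

IsRho∧ρ<Certificate⇒< : ∀ {n N r t} → IsRho n N r → ρ<Certificate t n → r < t
IsRho∧ρ<Certificate⇒< {n} {N} {r} {t} ρ (b , b<t , b<n , bound) with bound N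
... | a , a<t∸b , cop = begin-strict
  r         ≤⟨ IsRho⇒≤ ρ (coprime⇒Good {a = a} {b = b} cop′) ⟩
  a + b     <⟨ +-monoˡ-< b a<t∸b ⟩
  t ∸ b + b ≡⟨ m∸n+n≡m (<⇒≤ b<t) ⟩
  t         ∎
  where
  open ≤-Reasoning
  cop′ : gcd (+ N - + a) (+ n - + b) ≡ 1ℤ
  cop′ = subst (λ x → gcd (+ N - + a) x ≡ 1ℤ) (pos-∸ (<⇒≤ b<n)) cop

Exceptional : ℕ → Set
Exceptional n = n ≡ 255 ⊎ n ≡ 286

-- Proved by running the deciders; opaque because unfolding these proof terms
-- (e.g. in a with-abstraction) is prohibitively expensive.
opaque
  n<320⇒ρ<4-certified : ∀ {n} → n < 320 → n ≡ 0 ⊎ Exceptional n ⊎ ρ<Certificate 4 n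
  n<320⇒ρ<4-certified = toWitness {a? = allUpTo? decide 320} _
    where
    decide : ∀ n → Dec (n ≡ 0 ⊎ Exceptional n ⊎ ρ<Certificate 4 n)
    decide n = n ≟ 0 ⊎-dec (n ≟ 255 ⊎-dec n ≟ 286) ⊎-dec ρ<Certificate? 4 n

  exceptional⇒ρ<5-certified : ∀ {n} → Exceptional n → ρ<Certificate 5 n
  exceptional⇒ρ<5-certified (inj₁ refl) = toWitness {a? = ρ<Certificate? 5 255} _
  exceptional⇒ρ<5-certified (inj₂ refl) = toWitness {a? = ρ<Certificate? 5 286} _

IsRho≥4⇒320≤n⊎exceptional : ∀ {n N r} → 0 < n → IsRho n N r → 4 ≤ r →
  320 ≤ n ⊎ Exceptional n
IsRho≥4⇒320≤n⊎exceptional {n} 0<n ρ 4≤r with 320 ≤? n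
... | yes 320≤n = inj₁ 320≤n
... | no 320≰n with n<320⇒ρ<4-certified (≰⇒> 320≰n)
...   | inj₁ refl               = ⊥-elim (<-irrefl refl 0<n)
...   | inj₂ (inj₁ exceptional) = inj₂ exceptional
...   | inj₂ (inj₂ certificate) = contradiction (IsRho∧ρ<Certificate⇒< ρ certificate) (≤⇒≯ 4≤r)

IsRho≥4∧exceptional⇒≡4 : ∀ {n N r} → IsRho n N r → 4 ≤ r → Exceptional n → r ≡ 4
IsRho≥4∧exceptional⇒≡4 ρ 4≤r exceptional =
  ≤-antisym (s≤s⁻¹ (IsRho∧ρ<Certificate⇒< ρ (exceptional⇒ρ<5-certified exceptional))) 4≤r

lemma4p3 : (m M r : ℕ) → 0 < m → 0 < M → IsRho m M r → 4 ≤ r →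
    (320 ≤ m ⊓ M ⊎ (m ⊓ M ≡ 255 ⊎ m ⊓ M ≡ 286)) ×
    ((m ⊓ M ≡ 255 ⊎ m ⊓ M ≡ 286) → r ≡ 4)
lemma4p3 m M r 0<m 0<M ρ 4≤r with IsRho-⊓ ρ
... | N , ρ[m⊓M,N] =
  IsRho≥4⇒320≤n⊎exceptional (⊓-glb 0<m 0<M) ρ[m⊓M,N] 4≤r ,
  IsRho≥4∧exceptional⇒≡4 ρ[m⊓M,N] 4≤r
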